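{- Dominating sets can be learned by extended equivalence queries and membership queries in $O(n^2)$ rounds: there is a learning algorithm using extended equivalence queries and membership queries that, for every graph $G$ on $\{1,\dots,n\}$ and every competent Teacher, produces a hypothesis equivalent to $G$ with respect to the dominating set concept after $O(n^2)$ queries in total.
   Context: A vertex set concept is a predicate $\Phi(G,V')$ on finite graphs $G$ and sets $V'\subseteq V(G)$; its solution set is $S(G)=\{V'\subseteq V(G):\Phi(G,V')\}$. Here $\Phi(G,V')$ means "$V'$ is a dominating set of $G$", i.e. every vertex of $G$ either lies in $V'$ or is adjacent to a vertex of $V'$. Learning model (exact learning by extended equivalence and membership queries): a Teacher privately holds a graph $G$ with vertex set $V=\{1,\dots,n\}$, and the Learner initially knows only $n$. - In a membership query the Learner presents a set $V'\subseteq\{1,\dots,n\}$, and the Teacher answers whether $\Phi(G,V')$ holds. - In an extended equivalence query the Learner presents a Boolean circuit $C$ with $n$ inputs and one output. A set $U\subseteq\{1,\dots,n\}$ is identified with its characteristic $0$-$1$ vector. The circuit $C$ is equivalent to $G$ if $C$ outputs $1$ exactly on the characteristic vectors of the sets in $S(G)$. If $C$ is equivalent, the Teacher answers "finished". Otherwise the Teacher returns a counterexample: either a positive counterexample, i.e. a set in $S(G)$ rejected by $C$, or a negative counterexample, i.e. a set accepted by $C$ but not in $S(G)$. A Teacher is competent if it always answers correctly; it may choose any valid counterexample. A learning algorithm is a Learner strategy that, against every competent Teacher and every $G$, eventually obtains "finished". It runs in $f(n)$ rounds if, for every graph of order $n$ and every competent Teacher, it finishes after at most $f(n)$ queries. 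-}

module Defs where

open import Data.Nat using (ℕ; zero; suc; _*_; _≤_)
open import Data.Fin using (Fin)
open import Data.Fin.Subset using (Subset; _∈_; _∉_)
open import Data.Bool using (Bool; true; false; _∧_; _∨_; not)
open import Data.Vec using (Vec; lookup; _∷ʳ_; last)
open import Data.Product using (Σ; ∃; _×_; _,_)
open import Data.Sum using (_⊎_)
open import Data.Empty using (⊥)
open import Relation.Nullary using (¬_)
open import Relation.Binary.PropositionalEquality using (_≡_)

-- Finite simple graphs on the vertex set {1,…,n}, represented as Fin n.

record Graph (n : ℕ) : Set where
  field
    adj   : Fin n → Fin n → Bool
    sym   : ∀ u v → adj u v ≡ adj v u
    irrefl : ∀ v → adj v v ≡ false

open Graph public

-- Sets V' ⊆ V are Data.Fin.Subset (characteristic 0-1 vectors, true = member).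

Dominating : ∀ {n} → Graph n → Subset n → Set
Dominating {n} G V' =
  ∀ (v : Fin n) → v ∈ V' ⊎ (∃ λ (u : Fin n) → u ∈ V' × adj G u v ≡ true)

-- Boolean circuits with n inputs and one output, as straight-line programs.
-- A gate in a program with m wires already available reads earlier wires.

data Gate (m : ℕ) : Set where
  const : Bool → Gate m
  andG  : Fin m → Fin m → Gate m
  orG   : Fin m → Fin m → Gate m
  notG  : Fin m → Gate m

-- Prog n m : a program on n inputs that has produced m wires in total
-- (the n input wires followed by the gate wires).
data Prog (n : ℕ) : ℕ → Set where
  inputs : Prog n n
  _▷_    : ∀ {m} → Prog n m → Gate m → Prog n (suc m)

evalGate : ∀ {m} → Gate m → Vec Bool m → Bool
evalGate (const b)  w = b
evalGate (andG i j) w = lookup w i ∧ lookup w j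
evalGate (orG i j)  w = lookup w i ∨ lookup w j
evalGate (notG i)   w = not (lookup w i)

wires : ∀ {n m} → Prog n m → Vec Bool n → Vec Bool m
wires inputs    x = x
wires (p ▷ g) x = let w = wires p x in w ∷ʳ evalGate g w

-- A circuit: a program with at least one wire; the output is the last wire.
record Circuit (n : ℕ) : Set where
  constructor circuit
  field
    width : ℕ
    prog  : Prog n (suc width)

evalC : ∀ {n} → Circuit n → Subset n → Bool
evalC (circuit _ p) U = last (wires p U)

data Counterexample (n : ℕ) : Set where
  positive : Subset n → Counterexample n
  negative : Subset n → Counterexample n

ValidCE : ∀ {n} → Graph n → Circuit n → Counterexample n → Set
ValidCE G C (positive U) = Dominating G U × evalC C U ≡ false
ValidCE G C (negative U) = ¬ Dominating G U × evalC C U ≡ true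

-- A Learner strategy (knowing n) as a decision tree: at each step it asks a
-- membership query or an extended equivalence query and continues according
-- to the answer.  'giveUp' is a leaf at which the Learner stops without
-- having obtained "finished" (a failure).
data Learner (n : ℕ) : Set where
  giveUp : Learner n
  memQ   : Subset n → (Bool → Learner n) → Learner n
  eqQ    : Circuit n → (Counterexample n → Learner n) → Learner n

-- FinishesWithin G k L : against every competent Teacher holding G, the
-- Learner L obtains "finished" after at most k queries.
--  * A membership query is answered correctly (answer true iff Φ(G,V')).
--  * An equivalence query with an equivalent circuit is answered "finished"
--    (then there is no valid counterexample, so the quantification below is
--    vacuous); otherwise the Teacher may return any valid counterexample.
FinishesWithin : ∀ {n} → Graph n → ℕ → Learner n → Set
FinishesWithin G zero    L          = ⊥
FinishesWithin G (suc k) giveUp     = ⊥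
FinishesWithin G (suc k) (memQ V f) =
  ∀ (b : Bool) → (b ≡ true → Dominating G V) → (Dominating G V → b ≡ true) →
  FinishesWithin G k (f b)
FinishesWithin G (suc k) (eqQ C f)  =
  ∀ (ce : Counterexample _) → ValidCE G C ce → FinishesWithin G k (f ce)

BigOSquare : (ℕ → ℕ) → Set
BigOSquare f = ∃ λ (c : ℕ) → ∃ λ (N₀ : ℕ) → ∀ n → N₀ ≤ n → f n ≤ c * (n * n)

{-# OPTIONS --safe #-}
-- The Learner's hypothesis is "U meets each of the closed neighbourhoods N[w] found so far",
-- which every dominating set satisfies, so no positive counterexample can ever be returned.
-- A negative counterexample U is grown, one membership query per vertex, into a maximal
-- non-dominating set S ⊇ U.  The complement of a maximal non-dominating set is a closed
-- neighbourhood N[w], and w is new: U satisfies the hypothesis but does not dominate w.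
-- Hence there are at most n + 1 equivalence queries, each followed by n membership queries.
module Submission where

open import Defs hiding (sym)
open import Data.Bool using (Bool; true; false; _∧_; _∨_; T)
open import Data.Bool.Properties using (∨-idem; T-≡; T-∧; T-∨)
import Data.Bool.Properties as Bool
open import Data.Empty using (⊥-elim)
open import Data.Fin using (Fin; zero; suc; inject₁; fromℕ)
open import Data.Fin.Properties using (any?; ¬∀⟶∃¬; ⊎⇔∃)
open import Data.Fin.Subset using (Subset; _∈_; _∉_; _⊆_; _∪_; _∩_; ∁; ⁅_⁆; ∣_∣; Nonempty)
  renaming (⊥ to ∅)
open import Data.Fin.Subset.Properties
  using (_∈?_; ∉⊥; ∣p∣≤n; p⊂q⇒∣p∣<∣q∣; x∈⁅x⁆; x∈⁅y⁆⇒x≡y; x∈p∪q⁺; x∈p∪q⁻; q⊆p∪q;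
         x∈p∩q⁺; x∈p∩q⁻; x∈∁p⇒x∉p; x∉p⇒x∈∁p)
open import Data.List using (List; []; _∷_)
open import Data.List.Relation.Unary.All using (All; []; _∷_; uncons)
open import Data.Nat using (ℕ; zero; suc; _+_; _*_; _≤_; _<_)
open import Data.Nat.Properties
  using (<⇒≱; ≤-trans; n<1+n; m≤m+n; +-suc; +-monoˡ-≤; +-monoʳ-≤; *-mono-≤; module ≤-Reasoning)
open import Data.Nat.Tactic.RingSolver using (solve-∀)
open import Data.Product using (Σ; ∃; _×_; _,_; map₂)
open import Data.Product.Function.NonDependent.Propositional using (_×-⇔_)
open import Data.Sum using (_⊎_; inj₁; inj₂)
import Data.Sum as Sum
open import Data.Sum.Function.Propositional using (_⊎-⇔_)
open import Data.Unit using (tt)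
open import Data.Vec using (Vec; []; _∷_; lookup; _∷ʳ_; last; allFin)
open import Data.Vec.Properties using (last-∷ʳ; []=⇒lookup; lookup⇒[]=)
open import Data.Vec.Relation.Unary.All as Vec using ([]; _∷_)
open import Data.Vec.Membership.Propositional.Properties using (∈-allFin⁺)
open import Function using (id; _∘_)
open import Function.Bundles using (_⇔_; mk⇔; Equivalence)
open import Function.Construct.Composition using (_⇔-∘_)
open import Function.Construct.Identity using (⇔-id)
open import Relation.Binary.PropositionalEquality
  using (_≡_; refl; sym; trans; cong₂; subst; module ≡-Reasoning)
open import Relation.Nullary using (¬_; contradiction)
open import Relation.Nullary.Decidable using (_⊎-dec_; _×-dec_)
open import Relation.Unary using (Decidable)

open Equivalence using (to; from)

private
  variable
    n m k l : ℕ

lookup-∷ʳ-inject₁ : {A : Set} (xs : Vec A m) (x : A) (i : Fin m) →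
                    lookup (xs ∷ʳ x) (inject₁ i) ≡ lookup xs i
lookup-∷ʳ-inject₁ (y ∷ xs) x zero    = refl
lookup-∷ʳ-inject₁ (y ∷ xs) x (suc i) = lookup-∷ʳ-inject₁ xs x i

lookup-∷ʳ-fromℕ : {A : Set} (xs : Vec A m) (x : A) → lookup (xs ∷ʳ x) (fromℕ m) ≡ x
lookup-∷ʳ-fromℕ []       x = refl
lookup-∷ʳ-fromℕ (y ∷ xs) x = lookup-∷ʳ-fromℕ xs x

data Formula (n : ℕ) : Set where
  var       : Fin n → Formula n
  const     : Bool → Formula n
  _∧ᶠ_ _∨ᶠ_ : Formula n → Formula n → Formula n

⟦_⟧ : Formula n → Subset n → Bool
⟦ var i ⟧   x = lookup x i
⟦ const b ⟧ x = b
⟦ φ ∧ᶠ ψ ⟧  x = ⟦ φ ⟧ x ∧ ⟦ ψ ⟧ x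
⟦ φ ∨ᶠ ψ ⟧  x = ⟦ φ ⟧ x ∨ ⟦ ψ ⟧ x

record _⊑_ (p : Prog n m) (q : Prog n k) : Set where
  field
    embed       : Fin m → Fin k
    embed-wires : ∀ x i → lookup (wires q x) (embed i) ≡ lookup (wires p x) i
open _⊑_

⊑-refl : {p : Prog n m} → p ⊑ p
⊑-refl = record { embed = id ; embed-wires = λ _ _ → refl }

⊑-trans : {p : Prog n m} {q : Prog n k} {r : Prog n l} → p ⊑ q → q ⊑ r → p ⊑ r
⊑-trans p⊑q q⊑r = record
  { embed       = embed q⊑r ∘ embed p⊑q
  ; embed-wires = λ x i → trans (embed-wires q⊑r x (embed p⊑q i)) (embed-wires p⊑q x i)
  }

⊑-▷ : {p : Prog n m} {g : Gate m} → p ⊑ (p ▷ g)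
⊑-▷ {p = p} = record { embed = inject₁ ; embed-wires = λ x → lookup-∷ʳ-inject₁ (wires p x) _ }

record Computing (p : Prog n m) (f : Subset n → Bool) : Set where
  field
    {width}        : ℕ
    program        : Prog n width
    extends        : p ⊑ program
    output         : Fin width
    output-correct : ∀ x → lookup (wires program x) output ≡ f x
open Computing

gate-on : (p : Prog n m) (g : Gate m) → Computing p (λ x → evalGate g (wires p x))
gate-on {m = m} p g = record
  { program        = p ▷ g
  ; extends        = ⊑-▷
  ; output         = fromℕ m
  ; output-correct = λ x → lookup-∷ʳ-fromℕ (wires p x) _
  }

combine : {p : Prog n m} {f h : Subset n → Bool}
          (_∙_ : Bool → Bool → Bool) (gate : ∀ {k} → Fin k → Fin k → Gate k) →
          (∀ {k} (w : Vec Bool k) i j → evalGate (gate i j) w ≡ lookup w i ∙ lookup w j) →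
          (c : Computing p f) → Computing (program c) h → Computing p (λ x → f x ∙ h x)
combine {f = f} {h} _∙_ gate gate-sem c d = record
  { program        = program r
  ; extends        = ⊑-trans (extends c) (⊑-trans (extends d) (extends r))
  ; output         = output r
  ; output-correct = correct
  }
  where
  i = embed (extends d) (output c)
  r = gate-on (program d) (gate i (output d))

  correct : ∀ x → lookup (wires (program r) x) (output r) ≡ f x ∙ h x
  correct x = begin
    lookup (wires (program r) x) (output r) ≡⟨ output-correct r x ⟩
    evalGate (gate i (output d)) w          ≡⟨ gate-sem w i (output d) ⟩
    lookup w i ∙ lookup w (output d)        ≡⟨ cong₂ _∙_ c-correct (output-correct d x) ⟩
    f x ∙ h x                               ∎
    where
    open ≡-Reasoning
    w = wires (program d) x
    c-correct : lookup w i ≡ f x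
    c-correct = trans (embed-wires (extends d) x (output c)) (output-correct c x)

compile : {p : Prog n m} → inputs ⊑ p → (φ : Formula n) → Computing p ⟦ φ ⟧
compile inputs⊑p (var i) = record
  { program        = _
  ; extends        = ⊑-refl
  ; output         = embed inputs⊑p i
  ; output-correct = λ x → embed-wires inputs⊑p x i
  }
compile {p = p} _ (const b) = gate-on p (const b)
compile inputs⊑p (φ ∧ᶠ ψ) =
  combine _∧_ andG (λ _ _ _ → refl) c (compile (⊑-trans inputs⊑p (extends c)) ψ)
  where c = compile inputs⊑p φ
compile inputs⊑p (φ ∨ᶠ ψ) =
  combine _∨_ orG (λ _ _ _ → refl) c (compile (⊑-trans inputs⊑p (extends c)) ψ)
  where c = compile inputs⊑p φ

-- evalC reads the last wire, so the output wire is copied there by or-ing it with itself.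
formula-circuit : Formula n → Circuit n
formula-circuit {n} φ = circuit (width c) (program c ▷ orG (output c) (output c))
  where c = compile (⊑-refl {p = inputs {n}}) φ

evalC-formula-circuit : (φ : Formula n) (x : Subset n) → evalC (formula-circuit φ) x ≡ ⟦ φ ⟧ x
evalC-formula-circuit {n} φ x = begin
  last (wires (program c) x ∷ʳ (y ∨ y)) ≡⟨ last-∷ʳ (y ∨ y) (wires (program c) x) ⟩
  y ∨ y                                 ≡⟨ ∨-idem y ⟩
  y                                     ≡⟨ output-correct c x ⟩
  ⟦ φ ⟧ x                               ∎
  where
  open ≡-Reasoning
  c = compile (⊑-refl {p = inputs {n}}) φ
  y = lookup (wires (program c) x) (output c)

⋁ : (Fin m → Formula n) → Formula n
⋁ {m = zero}  φ = const false
⋁ {m = suc m} φ = φ zero ∨ᶠ ⋁ (φ ∘ suc)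

T-⋁ : (φ : Fin m → Formula n) (x : Subset n) → T (⟦ ⋁ φ ⟧ x) ⇔ ∃ λ i → T (⟦ φ i ⟧ x)
T-⋁ {m = zero}  φ x = mk⇔ (λ ()) λ ()
T-⋁ {m = suc m} φ x = ⊎⇔∃ ⇔-∘ ((⇔-id _ ⊎-⇔ T-⋁ (φ ∘ suc) x) ⇔-∘ T-∨)

T-lookup⇔∈ : {p : Subset n} {i : Fin n} → T (lookup p i) ⇔ i ∈ p
T-lookup⇔∈ {p = p} {i} = mk⇔ (lookup⇒[]= i p ∘ to T-≡) (from T-≡ ∘ []=⇒lookup)

meets : Subset n → Formula n
meets N = ⋁ λ i → var i ∧ᶠ const (lookup N i)

T-meets : (N U : Subset n) → T (⟦ meets N ⟧ U) ⇔ Nonempty (U ∩ N)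
T-meets N U = mk⇔ (map₂ (to T-∈∩)) (map₂ (from T-∈∩)) ⇔-∘ T-⋁ _ U
  where
  T-∈∩ : {i : Fin _} → T (lookup U i ∧ lookup N i) ⇔ i ∈ U ∩ N
  T-∈∩ = mk⇔ x∈p∩q⁺ (x∈p∩q⁻ U N) ⇔-∘ ((T-lookup⇔∈ ×-⇔ T-lookup⇔∈) ⇔-∘ T-∧)

MeetsAll : List (Subset n) → Subset n → Set
MeetsAll Ns U = All (λ N → Nonempty (U ∩ N)) Ns

meetsAll : List (Subset n) → Formula n
meetsAll []       = const true
meetsAll (N ∷ Ns) = meets N ∧ᶠ meetsAll Ns

T-meetsAll : (Ns : List (Subset n)) (U : Subset n) → T (⟦ meetsAll Ns ⟧ U) ⇔ MeetsAll Ns U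
T-meetsAll []       U = mk⇔ (λ _ → []) (λ _ → tt)
T-meetsAll (N ∷ Ns) U =
  mk⇔ (λ (m , ms) → m ∷ ms) uncons ⇔-∘ ((T-meets N U ×-⇔ T-meetsAll Ns U) ⇔-∘ T-∧)

hypothesis : List (Subset n) → Circuit n
hypothesis Ns = formula-circuit (meetsAll Ns)

T-hypothesis : (Ns : List (Subset n)) (U : Subset n) → T (evalC (hypothesis Ns) U) ⇔ MeetsAll Ns U
T-hypothesis Ns U rewrite evalC-formula-circuit (meetsAll Ns) U = T-meetsAll Ns U

Dominates : Graph n → Subset n → Fin n → Set
Dominates G V v = v ∈ V ⊎ ∃ λ u → u ∈ V × adj G u v ≡ true

IsClosedNbhd : Graph n → Fin n → Subset n → Set
IsClosedNbhd G w N = ∀ i → i ∈ N ⇔ (i ≡ w ⊎ adj G i w ≡ true)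

Saturated : Graph n → Subset n → Fin n → Set
Saturated G S i = i ∈ S ⊎ Dominating G (⁅ i ⁆ ∪ S)

module _ (G : Graph n) where

  dominates? : (V : Subset n) → Decidable (Dominates G V)
  dominates? V v = v ∈? V ⊎-dec any? λ u → u ∈? V ×-dec adj G u v Bool.≟ true

  undominated-vertex : {V : Subset n} → ¬ Dominating G V → ∃ λ w → ¬ Dominates G V w
  undominated-vertex {V} = ¬∀⟶∃¬ n (Dominates G V) (dominates? V)

  Dominates-mono : {V W : Subset n} {v : Fin n} → V ⊆ W → Dominates G V v → Dominates G W v
  Dominates-mono V⊆W = Sum.map V⊆W (map₂ λ (u∈V , adj-uv) → V⊆W u∈V , adj-uv)

  Dominating-mono : {V W : Subset n} → V ⊆ W → Dominating G V → Dominating G W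
  Dominating-mono V⊆W dom v = Dominates-mono V⊆W (dom v)

  Dominates-∪⁻ : (V W : Subset n) {v : Fin n} →
                 Dominates G (V ∪ W) v → Dominates G V v ⊎ Dominates G W v
  Dominates-∪⁻ V W (inj₁ v∈V∪W) = Sum.map inj₁ inj₁ (x∈p∪q⁻ V W v∈V∪W)
  Dominates-∪⁻ V W (inj₂ (u , u∈V∪W , adj-uv)) =
    Sum.map (λ u∈V → inj₂ (u , u∈V , adj-uv)) (λ u∈W → inj₂ (u , u∈W , adj-uv))
            (x∈p∪q⁻ V W u∈V∪W)

  Dominates-⁅⁆⁻ : {i v : Fin n} → Dominates G ⁅ i ⁆ v → i ≡ v ⊎ adj G i v ≡ true
  Dominates-⁅⁆⁻ {i} (inj₁ v∈⁅i⁆) = inj₁ (sym (x∈⁅y⁆⇒x≡y i v∈⁅i⁆))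
  Dominates-⁅⁆⁻ {i} {v} (inj₂ (u , u∈⁅i⁆ , adj-uv)) =
    inj₂ (subst (λ u → adj G u v ≡ true) (x∈⁅y⁆⇒x≡y i u∈⁅i⁆) adj-uv)

  dominates⇔meets : {w : Fin n} {N U : Subset n} →
                    IsClosedNbhd G w N → Dominates G U w ⇔ Nonempty (U ∩ N)
  dominates⇔meets {w} {N} {U} N[w] = mk⇔ meet dominate
    where
    meet : Dominates G U w → Nonempty (U ∩ N)
    meet (inj₁ w∈U)              = w , x∈p∩q⁺ (w∈U , from (N[w] w) (inj₁ refl))
    meet (inj₂ (u , u∈U , adj-uw)) = u , x∈p∩q⁺ (u∈U , from (N[w] u) (inj₂ adj-uw))

    dominate : Nonempty (U ∩ N) → Dominates G U w
    dominate (i , i∈U∩N) with x∈p∩q⁻ U N i∈U∩N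
    ... | i∈U , i∈N with to (N[w] i) i∈N
    ... | inj₁ refl   = inj₁ i∈U
    ... | inj₂ adj-iw = inj₂ (i , i∈U , adj-iw)

  Saturated-mono : {S S′ : Subset n} {i : Fin n} → S ⊆ S′ → Saturated G S i → Saturated G S′ i
  Saturated-mono S⊆S′ =
    Sum.map S⊆S′ (Dominating-mono λ x∈ → x∈p∪q⁺ (Sum.map₂ S⊆S′ (x∈p∪q⁻ _ _ x∈)))

  -- For w undominated by S, N[w] avoids S, and adding any i ∉ S dominates w only if i ∈ N[w].
  maximal-nondominating⇒closedNbhd : {S : Subset n} →
    ¬ Dominating G S → (∀ i → Saturated G S i) → ∃ λ w → IsClosedNbhd G w (∁ S)
  maximal-nondominating⇒closedNbhd {S} ¬dom saturated with undominated-vertex ¬dom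
  ... | w , ¬dom-w = w , λ i → mk⇔ (near i) (outside i)
    where
    near : ∀ i → i ∈ ∁ S → i ≡ w ⊎ adj G i w ≡ true
    near i i∈∁S with saturated i
    ... | inj₁ i∈S = contradiction i∈S (x∈∁p⇒x∉p i∈∁S)
    ... | inj₂ dom with Dominates-∪⁻ ⁅ i ⁆ S (dom w)
    ... | inj₁ dom-by-i = Dominates-⁅⁆⁻ dom-by-i
    ... | inj₂ dom-by-S = contradiction dom-by-S ¬dom-w

    outside : ∀ i → i ≡ w ⊎ adj G i w ≡ true → i ∈ ∁ S
    outside i (inj₁ refl)   = x∉p⇒x∈∁p λ w∈S → ¬dom-w (inj₁ w∈S)
    outside i (inj₂ adj-iw) = x∉p⇒x∈∁p λ i∈S → ¬dom-w (inj₂ (i , i∈S , adj-iw))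

maximise : Vec (Fin n) m → Subset n → (Subset n → Learner n) → Learner n
maximise []       S continue = continue S
maximise (i ∷ is) S continue = memQ (⁅ i ⁆ ∪ S) λ where
  true  → maximise is S continue
  false → maximise is (⁅ i ⁆ ∪ S) continue

learner : ℕ → List (Subset n) → Learner n
learner         zero    Ns = giveUp
learner {n = n} (suc k) Ns = eqQ (hypothesis Ns) λ where
  (positive _) → giveUp
  (negative U) → maximise (allFin n) U λ S → learner k (∁ S ∷ Ns)

module _ (G : Graph n) where

  maximise-finishes : (is : Vec (Fin n) m) (S : Subset n)
    {continue : Subset n → Learner n} {b : ℕ} → ¬ Dominating G S →
    (∀ {S′} → S ⊆ S′ → ¬ Dominating G S′ → Vec.All (Saturated G S′) is →
      FinishesWithin G b (continue S′)) →
    FinishesWithin G (m + b) (maximise is S continue)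
  maximise-finishes []       S ¬dom finish = finish id ¬dom []
  maximise-finishes (i ∷ is) S ¬dom finish true dom _ =
    maximise-finishes is S ¬dom λ S⊆S′ ¬dom′ saturated →
      finish S⊆S′ ¬dom′ (Saturated-mono G S⊆S′ (inj₂ (dom refl)) ∷ saturated)
  maximise-finishes (i ∷ is) S ¬dom finish false _ nondom =
    maximise-finishes is (⁅ i ⁆ ∪ S) (λ dom → contradiction (nondom dom) λ ())
      λ i∪S⊆S′ ¬dom′ saturated →
        finish (λ x∈S → i∪S⊆S′ (q⊆p∪q ⁅ i ⁆ S x∈S)) ¬dom′
               (inj₁ (i∪S⊆S′ (x∈p∪q⁺ (inj₁ (x∈⁅x⁆ i)))) ∷ saturated)

  -- W holds the vertices whose domination the hypothesis already enforces; it grows every round.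
  record Invariant (Ns : List (Subset n)) (W : Subset n) : Set where
    field
      dominating⇒meetsAll : ∀ {U} → Dominating G U → MeetsAll Ns U
      meetsAll⇒dominates  : ∀ {U w} → MeetsAll Ns U → w ∈ W → Dominates G U w
  open Invariant

  invariant-[] : Invariant [] ∅
  invariant-[] = record
    { dominating⇒meetsAll = λ _ → []
    ; meetsAll⇒dominates  = λ _ w∈∅ → ⊥-elim (∉⊥ w∈∅)
    }

  invariant-∷ : {Ns : List (Subset n)} {W N : Subset n} {w : Fin n} →
                Invariant Ns W → IsClosedNbhd G w N → Invariant (N ∷ Ns) (⁅ w ⁆ ∪ W)
  invariant-∷ {W = W} {w = w} inv N[w] = record
    { dominating⇒meetsAll = λ dom →
        to (dominates⇔meets G N[w]) (dom w) ∷ dominating⇒meetsAll inv dom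
    ; meetsAll⇒dominates  = dominated
    }
    where
    dominated : ∀ {U v} → MeetsAll (_ ∷ _) U → v ∈ ⁅ w ⁆ ∪ W → Dominates G U v
    dominated (meets-N ∷ meets-Ns) v∈ with x∈p∪q⁻ ⁅ w ⁆ W v∈
    ... | inj₁ v∈⁅w⁆ rewrite x∈⁅y⁆⇒x≡y w v∈⁅w⁆ = from (dominates⇔meets G N[w]) meets-N
    ... | inj₂ v∈W = meetsAll⇒dominates inv meets-Ns v∈W

  fresh-centre : {Ns : List (Subset n)} {W U S : Subset n} {w : Fin n} →
                 Invariant Ns W → MeetsAll Ns U → U ⊆ S → IsClosedNbhd G w (∁ S) → w ∉ W
  fresh-centre {U = U} {S} inv meets-Ns U⊆S N[w] w∈W
    with to (dominates⇔meets G N[w]) (meetsAll⇒dominates inv meets-Ns w∈W)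
  ... | i , i∈U∩∁S with x∈p∩q⁻ U (∁ S) i∈U∩∁S
  ... | i∈U , i∈∁S = x∈∁p⇒x∉p i∈∁S (U⊆S i∈U)

  learner-finishes : ∀ k (Ns : List (Subset n)) (W : Subset n) →
                     Invariant Ns W → n < k + ∣ W ∣ → FinishesWithin G (k * suc n) (learner k Ns)
  learner-finishes zero    Ns W inv n<∣W∣ = <⇒≱ n<∣W∣ (∣p∣≤n W)
  learner-finishes (suc k) Ns W inv bound (positive U) (dom , rejected) =
    ⊥-elim (subst T rejected (from (T-hypothesis Ns U) (dominating⇒meetsAll inv dom)))
  learner-finishes (suc k) Ns W inv bound (negative U) (¬dom , accepted) =
    maximise-finishes (allFin n) U ¬dom next
    where
    meets-Ns : MeetsAll Ns U
    meets-Ns = to (T-hypothesis Ns U) (from T-≡ accepted)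

    next : ∀ {S} → U ⊆ S → ¬ Dominating G S → Vec.All (Saturated G S) (allFin n) →
           FinishesWithin G (k * suc n) (learner k (∁ S ∷ Ns))
    next U⊆S ¬dom-S saturated
      with maximal-nondominating⇒closedNbhd G ¬dom-S (λ i → Vec.lookup saturated (∈-allFin⁺ i))
    ... | w , N[w] = learner-finishes k _ (⁅ w ⁆ ∪ W) (invariant-∷ inv N[w]) bound′
      where
      open ≤-Reasoning
      W-grows : ∣ W ∣ < ∣ ⁅ w ⁆ ∪ W ∣
      W-grows = p⊂q⇒∣p∣<∣q∣
        (q⊆p∪q ⁅ w ⁆ W , w , x∈p∪q⁺ (inj₁ (x∈⁅x⁆ w)) , fresh-centre inv meets-Ns U⊆S N[w])

      bound′ : n < k + ∣ ⁅ w ⁆ ∪ W ∣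
      bound′ = begin-strict
        n                   <⟨ bound ⟩
        suc k + ∣ W ∣       ≡⟨ sym (+-suc k ∣ W ∣) ⟩
        k + suc ∣ W ∣       ≤⟨ +-monoʳ-≤ k W-grows ⟩
        k + ∣ ⁅ w ⁆ ∪ W ∣   ∎

suc-square-≤ : 1 ≤ n → suc n * suc n ≤ 4 * (n * n)
suc-square-≤ {n} 1≤n = begin
  suc n * suc n     ≤⟨ *-mono-≤ suc-n≤n+n suc-n≤n+n ⟩
  (n + n) * (n + n) ≡⟨ square-double n ⟩
  4 * (n * n)       ∎
  where
  open ≤-Reasoning
  suc-n≤n+n : suc n ≤ n + n
  suc-n≤n+n = +-monoˡ-≤ n 1≤n
  square-double : ∀ n → (n + n) * (n + n) ≡ 4 * (n * n)
  square-double = solve-∀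

theorem2p3 : Σ ((n : ℕ) → Learner n) λ L →
             ∃ λ (f : ℕ → ℕ) →
               BigOSquare f × (∀ (n : ℕ) (G : Graph n) → FinishesWithin G (f n) (L n))
theorem2p3 =
    (λ n → learner (suc n) [])
  , (λ n → suc n * suc n)
  , (4 , 1 , λ _ → suc-square-≤)
  , λ n G → learner-finishes G (suc n) [] ∅ (invariant-[] G)
                             (≤-trans (n<1+n n) (m≤m+n (suc n) ∣ ∅ {n} ∣))
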